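{- If $G$ is an $r$-line-graph of density $d$, then $G$ contains a (nonempty, induced) subgraph $H$ such that $\mathrm{dens}(H)\geq d$ and $\delta(H)\geq \frac{d}{r}$.
   Context: Let $A_1,\dots,A_r$ be pairwise disjoint finite sets. An $r$-line-graph is a graph $G$ whose vertex set is a set $V(G)\subset A_1\times\dots\times A_r$, two vertices adjacent iff they differ in exactly one coordinate. Subgraphs of $r$-line-graphs are always induced subgraphs (themselves $r$-line-graphs). For $i\in[r]$, an $i$-block of $G$ is the set of all vertices of $G$ agreeing with a given vertex $x$ in all coordinates except possibly the $i$-th; a block is an $i$-block for some $i\in[r]$. With $p(G)$ the number of blocks, $\mathrm{dens}(G)=\frac{r|V(G)|}{p(G)}$. The $i$-degree $d^{(i)}(x)$ of $x$ is the size of the $i$-block containing $x$, and $\delta(G)$ is the minimum of $d^{(i)}(x)$ over all $x\in V(G)$, $i\in[r]$ (i.e. the minimum size of a block). -}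

module Defs where

open import Data.Nat using (ℕ; zero; suc; _*_; _⊓_; NonZero)
open import Data.Nat.Properties using () renaming (_≟_ to _≟ℕ_)
open import Data.Fin using (Fin)
open import Data.Fin.Properties using (all?) renaming (_≟_ to _≟F_)
open import Data.Vec using (Vec; lookup)
open import Data.Vec.Properties using (≡-dec)
open import Data.List using (List; []; _∷_; length; filter; map; concatMap; deduplicate; allFin)
open import Data.Nat.ListAction using (sum)
open import Data.List.Properties using () renaming (≡-dec to ≡-decL)
open import Data.List.Relation.Unary.Unique.Propositional using (Unique)
open import Data.Integer using (+_)
open import Data.Rational using (ℚ; _/_; 0ℚ)
open import Relation.Nullary using (Dec; ¬_)
open import Relation.Nullary.Decidable using (_→-dec_; ¬?)
open import Relation.Binary.PropositionalEquality using (_≡_)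

-- A vertex of an r-line-graph: a point of A₁ × … × A_r, coordinates coded as naturals
-- (the i-th coordinate ranges over the finite set A_i of values actually used).
Vertex : ℕ → Set
Vertex r = Vec ℕ r

_≟V_ : ∀ {r} (x y : Vertex r) → Dec (x ≡ y)
_≟V_ = ≡-dec _≟ℕ_

-- An r-line-graph: a finite set of vertices (a duplicate-free list).
-- Adjacency (differ in exactly one coordinate) is determined by the vertex set.
record LineGraph (r : ℕ) : Set where
  field
    verts    : List (Vertex r)
    distinct : Unique verts
open LineGraph public

AgreeExcept : ∀ {r} → Fin r → Vertex r → Vertex r → Set
AgreeExcept i x y = ∀ j → ¬ (j ≡ i) → lookup x j ≡ lookup y j

agreeExcept? : ∀ {r} (i : Fin r) (x y : Vertex r) → Dec (AgreeExcept i x y)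
agreeExcept? i x y = all? (λ j → ¬? (j ≟F i) →-dec (lookup x j ≟ℕ lookup y j))

block : ∀ {r} → LineGraph r → Fin r → Vertex r → List (Vertex r)
block G i x = filter (agreeExcept? i x) (verts G)

deg : ∀ {r} → LineGraph r → Fin r → Vertex r → ℕ
deg G i x = length (block G i x)

numBlocks : ∀ {r} → LineGraph r → Fin r → ℕ
numBlocks G i = length (deduplicate (≡-decL _≟V_) (map (block G i) (verts G)))

p : ∀ {r} → LineGraph r → ℕ
p {r} G = sum (map (numBlocks G) (allFin r))

-- dens(G) = r |V(G)| / p(G)   (only meaningful when p(G) > 0; set to 0 otherwise)
dens : ∀ {r} → LineGraph r → ℚ
dens {r} G with p G
... | zero  = 0ℚ
... | suc k = (+ (r * length (verts G))) / suc k

-- minimum of a list of naturals (0 for the empty list, never used)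
minList : List ℕ → ℕ
minList []           = 0
minList (x ∷ [])     = x
minList (x ∷ y ∷ ys) = x ⊓ minList (y ∷ ys)

δ : ∀ {r} → LineGraph r → ℕ
δ {r} G = minList (concatMap (λ x → map (λ i → deg G i x) (allFin r)) (verts G))

-- Repeatedly delete a smallest block. Let d = A/B be the target density. If the current graph H
-- has density at least d but a block of size s with r s < d, deleting that block removes s
-- vertices and at least one block, so A p(H') ≤ A (p(H) − 1) < r (|V(H)| − s) B: the density
-- stays (even strictly) above d, and in particular H' is nonempty. Since |V| decreases, the
-- process stops at a nonempty subgraph of density at least d all of whose blocks have size ≥ d/r.
module Submission where

open import Defs
open import Data.Nat using (ℕ; NonZero)
open import Data.Integer using (+_)
open import Data.List using ([])
open import Data.List.Relation.Binary.Subset.Propositional using (_⊆_)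
open import Data.Product using (Σ; _×_)
open import Relation.Nullary using (¬_)
open import Relation.Binary.PropositionalEquality using (_≡_)

import Data.Nat as ℕ
import Data.Nat.Properties as ℕₚ
open import Data.Nat.Induction using (<-wellFounded)
open import Data.Nat.ListAction using (sum)
open import Data.Nat.Tactic.RingSolver using (solve-∀)
import Data.Integer as ℤ
import Data.Integer.Properties as ℤₚ
open import Data.Rational using (toℚᵘ)
open import Data.Rational.Properties using (toℚᵘ-cancel-≤; toℚᵘ-fromℚᵘ; toℚᵘ-homo-*)
import Data.Rational.Unnormalised as ℚᵘ
import Data.Rational.Unnormalised.Properties as ℚᵘₚ
open import Data.Bool using (true; false)
open import Data.Empty using (⊥-elim)
open import Data.Fin as Fin using (Fin)
open import Data.List using (List; _∷_; length; filter; map; concatMap; deduplicate; allFin)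
open import Data.List.Properties using (filter-notAll; filter-all; length-map) renaming (≡-dec to ≡-decL)
open import Data.List.Membership.Propositional using (_∈_; find)
open import Data.List.Membership.Propositional.Properties
  using (∈-filter⁺; ∈-filter⁻; ∈-map⁺; ∈-map⁻; ∈-concatMap⁺; ∈-concatMap⁻; ∈-allFin; ∈-length;
         ∈-deduplicate⁺; ∈-deduplicate⁻)
open import Data.List.Relation.Unary.Any as Any using (here; there)
open import Data.List.Relation.Unary.All as All using (All)
open import Data.List.Relation.Unary.AllPairs using (_∷_)
open import Data.List.Relation.Unary.Unique.Propositional using (Unique)
open import Data.List.Relation.Unary.Unique.Propositional.Properties using (filter⁺)
import Data.List.Relation.Unary.Unique.DecPropositional.Properties as UniqueDec
open import Data.Product using (_,_; proj₁; proj₂; ∃; ∃₂)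
open import Data.Sum using (inj₁; inj₂)
open import Function using (id; _∘_)
open import Induction.WellFounded using (Acc; acc)
open import Level using (Level)
open import Relation.Nullary using (Dec; yes; no; does; ¬?)
open import Relation.Unary using (Pred; Decidable)
open import Relation.Binary.Definitions using (DecidableEquality)
open import Relation.Binary.PropositionalEquality using (_≢_; refl; sym; trans; cong; subst; subst₂)

module ListFacts where
  open import Data.Nat using (_≤_; _<_; _+_; z≤n; s≤s)
  open ℕₚ using (≤-trans; +-suc; +-mono-≤; +-mono-<-≤; +-mono-≤-<; m≤m+n; m≤n+m; ⊓-sel)

  module _ {a p q : Level} {A : Set a} {P : Pred A p} {Q : Pred A q} (P? : Decidable P) (Q? : Decidable Q) where

    filter-comm : ∀ xs → filter P? (filter Q? xs) ≡ filter Q? (filter P? xs)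
    filter-comm [] = refl
    filter-comm (x ∷ xs) with ih ← filter-comm xs | does (P? x) in eqP | does (Q? x) in eqQ
    ... | true  | true  rewrite eqP | eqQ = cong (x ∷_) ih
    ... | true  | false rewrite eqQ = ih
    ... | false | true  rewrite eqP = ih
    ... | false | false = ih

  length-filter-∁ : ∀ {a p} {A : Set a} {P : Pred A p} (P? : Decidable P) xs →
                    length (filter (¬? ∘ P?) xs) + length (filter P? xs) ≡ length xs
  length-filter-∁ P? [] = refl
  length-filter-∁ P? (x ∷ xs) with P? x
  ... | yes _ = trans (+-suc _ _) (cong ℕ.suc (length-filter-∁ P? xs))
  ... | no  _ = cong ℕ.suc (length-filter-∁ P? xs)

  Unique-⊆⇒length-≤ : ∀ {A : Set} → DecidableEquality A → ∀ {xs ys : List A} →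
                      Unique xs → xs ⊆ ys → length xs ≤ length ys
  Unique-⊆⇒length-≤ _≟_ {[]}     _              _     = z≤n
  Unique-⊆⇒length-≤ _≟_ {x ∷ xs} {ys} (x∉xs ∷ xs!) xs⊆ys =
    ≤-trans (s≤s (Unique-⊆⇒length-≤ _≟_ xs! xs⊆ys-x))
            (filter-notAll ≢x? ys (Any.map (λ z≡x z≢x → z≢x z≡x) (xs⊆ys (here refl))))
    where
    ≢x? = λ z → ¬? (x ≟ z)
    xs⊆ys-x : xs ⊆ filter ≢x? ys
    xs⊆ys-x z∈xs = ∈-filter⁺ ≢x? (xs⊆ys (there z∈xs)) (All.lookup x∉xs z∈xs)

  minList-∈ : ∀ {xs : List ℕ} {y} → y ∈ xs → minList xs ∈ xs
  minList-∈ {x ∷ xs} _ = minList-∷-∈ x xs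
    where
    minList-∷-∈ : ∀ x xs → minList (x ∷ xs) ∈ x ∷ xs
    minList-∷-∈ x []       = here refl
    minList-∷-∈ x (y ∷ ys) with ⊓-sel x (minList (y ∷ ys))
    ... | inj₁ min≡x = here min≡x
    ... | inj₂ min≡m = there (subst (_∈ y ∷ ys) (sym min≡m) (minList-∷-∈ y ys))

  ≢[]⇒∈ : ∀ {A : Set} {xs : List A} → ¬ xs ≡ [] → ∃ (_∈ xs)
  ≢[]⇒∈ {xs = []}    xs≢[] = ⊥-elim (xs≢[] refl)
  ≢[]⇒∈ {xs = x ∷ _} _     = x , here refl

  module _ {A : Set} where

    sum-map-mono-≤ : ∀ (xs : List A) {f g : A → ℕ} → (∀ x → f x ≤ g x) → sum (map f xs) ≤ sum (map g xs)
    sum-map-mono-≤ []       f≤g = z≤n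
    sum-map-mono-≤ (x ∷ xs) f≤g = +-mono-≤ (f≤g x) (sum-map-mono-≤ xs f≤g)

    sum-map-mono-< : ∀ {xs : List A} {f g : A → ℕ} → (∀ x → f x ≤ g x) →
                     ∀ {x} → x ∈ xs → f x < g x → sum (map f xs) < sum (map g xs)
    sum-map-mono-< {_ ∷ xs} f≤g (here refl) fx<gx = +-mono-<-≤ fx<gx (sum-map-mono-≤ xs f≤g)
    sum-map-mono-< {y ∷ _}  f≤g (there x∈)  fx<gx = +-mono-≤-< (f≤g y) (sum-map-mono-< f≤g x∈ fx<gx)

    ∈⇒≤sum-map : ∀ {xs : List A} (f : A → ℕ) {x} → x ∈ xs → f x ≤ sum (map f xs)
    ∈⇒≤sum-map f (here refl) = m≤m+n _ _
    ∈⇒≤sum-map f (there x∈)  = ≤-trans (∈⇒≤sum-map f x∈) (m≤n+m _ _)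

open ListFacts

module Blocks {r : ℕ} where
  open import Data.Nat using (_≤_; _<_; _+_)
  open ℕₚ using (≤-trans; ≤-reflexive)

  agree-refl : ∀ (i : Fin r) x → AgreeExcept i x x
  agree-refl i x j _ = refl

  agree-sym : ∀ {i : Fin r} {x y} → AgreeExcept i x y → AgreeExcept i y x
  agree-sym x~y j j≢i = sym (x~y j j≢i)

  agree-trans : ∀ {i : Fin r} {x y z} → AgreeExcept i x y → AgreeExcept i y z → AgreeExcept i x z
  agree-trans x~y y~z j j≢i = trans (x~y j j≢i) (y~z j j≢i)

  module _ (H : LineGraph r) (i : Fin r) {x : Vertex r} where

    ∈-block⁺ : x ∈ verts H → x ∈ block H i x
    ∈-block⁺ x∈ = ∈-filter⁺ (agreeExcept? i x) x∈ (agree-refl i x)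

    ∈-block⁻ : ∀ {y} → y ∈ block H i x → y ∈ verts H × AgreeExcept i x y
    ∈-block⁻ = ∈-filter⁻ (agreeExcept? i x)

  blocks : LineGraph r → Fin r → List (List (Vertex r))
  blocks H j = deduplicate (≡-decL _≟V_) (map (block H j) (verts H))

  blocks-unique : ∀ H j → Unique (blocks H j)
  blocks-unique H j = UniqueDec.deduplicate-! (≡-decL _≟V_) _

  module _ (H : LineGraph r) (j : Fin r) where

    ∈-blocks⁺ : ∀ {y} → y ∈ verts H → block H j y ∈ blocks H j
    ∈-blocks⁺ = ∈-deduplicate⁺ (≡-decL _≟V_) ∘ ∈-map⁺ (block H j)

    ∈-blocks⁻ : ∀ {b} → b ∈ blocks H j → ∃ λ y → y ∈ verts H × b ≡ block H j y
    ∈-blocks⁻ = ∈-map⁻ (block H j) ∘ ∈-deduplicate⁻ (≡-decL _≟V_) _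

  disagree? : (i : Fin r) (x : Vertex r) → Decidable (λ y → ¬ AgreeExcept i x y)
  disagree? i x = ¬? ∘ agreeExcept? i x

  removeBlock : LineGraph r → Fin r → Vertex r → LineGraph r
  removeBlock H i x = record
    { verts    = filter (disagree? i x) (verts H)
    ; distinct = filter⁺ (disagree? i x) (distinct H)
    }

  module _ (H : LineGraph r) (i : Fin r) (x : Vertex r) where
    private
      H′ = removeBlock H i x

    ∈-removeBlock⁻ : ∀ {y} → y ∈ verts H′ → y ∈ verts H × ¬ AgreeExcept i x y
    ∈-removeBlock⁻ = ∈-filter⁻ (disagree? i x)

    removeBlock-⊆ : verts H′ ⊆ verts H
    removeBlock-⊆ = proj₁ ∘ ∈-removeBlock⁻

    length-removeBlock : length (verts H′) + deg H i x ≡ length (verts H)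
    length-removeBlock = length-filter-∁ (agreeExcept? i x) (verts H)

    block-removeBlock : ∀ j y → block H′ j y ≡ filter (disagree? i x) (block H j y)
    block-removeBlock j y = filter-comm (agreeExcept? j y) (disagree? i x) (verts H)

    block-removeBlock-survivor : ∀ {y} → y ∈ verts H′ → block H′ i y ≡ block H i y
    block-removeBlock-survivor {y} y∈ =
      trans (block-removeBlock i y) (filter-all (disagree? i x) (All.tabulate disjoint))
      where
      disjoint : ∀ {z} → z ∈ block H i y → ¬ AgreeExcept i x z
      disjoint {z} z∈ x~z = proj₂ (∈-removeBlock⁻ y∈)
        (agree-trans {i} {x} {z} {y} x~z (agree-sym {i} {y} {z} (proj₂ (∈-block⁻ H i {y} z∈))))

    numBlocks-removeBlock-≤ : ∀ j → numBlocks H′ j ≤ numBlocks H j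
    numBlocks-removeBlock-≤ j =
      ≤-trans (Unique-⊆⇒length-≤ (≡-decL _≟V_) (blocks-unique H′ j) blocks′⊆)
              (≤-reflexive (length-map (filter (disagree? i x)) (blocks H j)))
      where
      blocks′⊆ : blocks H′ j ⊆ map (filter (disagree? i x)) (blocks H j)
      blocks′⊆ b∈ with ∈-blocks⁻ H′ j b∈
      ... | y , y∈ , refl = subst (_∈ _) (sym (block-removeBlock j y))
                              (∈-map⁺ (filter (disagree? i x)) (∈-blocks⁺ H j (removeBlock-⊆ y∈)))

    numBlocks-removeBlock-< : x ∈ verts H → numBlocks H′ i < numBlocks H i
    numBlocks-removeBlock-< x∈ =
      Unique-⊆⇒length-≤ (≡-decL _≟V_) (new ∷ blocks-unique H′ i) ⊆blocks
      where
      survivor-block : ∀ {b} → b ∈ blocks H′ i → ∃ λ y → y ∈ verts H′ × b ≡ block H i y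
      survivor-block b∈ with ∈-blocks⁻ H′ i b∈
      ... | y , y∈ , refl = y , y∈ , block-removeBlock-survivor y∈

      new : All (block H i x ≢_) (blocks H′ i)
      new = All.tabulate λ b∈ → distinct-from (survivor-block b∈)
        where
        distinct-from : ∀ {b} → (∃ λ y → y ∈ verts H′ × b ≡ block H i y) → block H i x ≢ b
        distinct-from (y , y∈ , b≡) x-block≡b = proj₂ (∈-removeBlock⁻ y∈) (agree-sym {i} {y} {x}
          (proj₂ (∈-block⁻ H i {y} (subst (x ∈_) (trans x-block≡b b≡) (∈-block⁺ H i x∈)))))

      ⊆blocks : block H i x ∷ blocks H′ i ⊆ blocks H i
      ⊆blocks (here refl) = ∈-blocks⁺ H i x∈
      ⊆blocks (there b∈) with survivor-block b∈
      ... | y , y∈ , refl = ∈-blocks⁺ H i (removeBlock-⊆ y∈)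

    p-removeBlock-< : x ∈ verts H → p H′ < p H
    p-removeBlock-< x∈ =
      sum-map-mono-< numBlocks-removeBlock-≤ (∈-allFin i) (numBlocks-removeBlock-< x∈)

open Blocks

module _ {r : ℕ} (H : LineGraph (ℕ.suc r)) (H≢[] : ¬ verts H ≡ []) where
  private
    v  = proj₁ (≢[]⇒∈ H≢[])
    v∈ = proj₂ (≢[]⇒∈ H≢[])

  p≡suc-pred : p H ≡ ℕ.suc (ℕ.pred (p H))
  p≡suc-pred = sym (ℕₚ.suc-pred (p H) {{ℕ.>-nonZero p-pos}})
    where
    p-pos : 0 ℕ.< p H
    p-pos = ℕₚ.<-≤-trans (∈-length (∈-blocks⁺ H Fin.zero v∈))
                         (∈⇒≤sum-map (numBlocks H) (∈-allFin Fin.zero))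

  δ-attained : ∃₂ λ x i → x ∈ verts H × δ H ≡ deg H i x
  δ-attained with find (∈-concatMap⁻ degrees {xs = verts H} (minList-∈ some-degree))
    where
    degrees : Vertex (ℕ.suc r) → List ℕ
    degrees x = map (λ i → deg H i x) (allFin (ℕ.suc r))
    some-degree : deg H Fin.zero v ∈ concatMap degrees (verts H)
    some-degree = ∈-concatMap⁺ degrees
      (Any.map (λ { refl → ∈-map⁺ (λ i → deg H i v) (∈-allFin Fin.zero) }) v∈)
  ... | x , x∈ , δ∈ with ∈-map⁻ (λ i → deg H i x) δ∈
  ... | i , _ , δ≡ = x , i , x∈ , δ≡

module Densification {r : ℕ} (A B : ℕ) where
  open import Data.Nat using (_≤_; _<_; _+_; _*_; _≤?_)
  open ℕₚ
    using (+-comm; *-suc; *-monoʳ-≤; *-distribˡ-+; *-distribʳ-+; +-monoʳ-<; +-cancelʳ-<;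
           m<m+n; <-≤-trans; ≤-reflexive; <⇒≤; ≰⇒>; n≮0; *-zeroʳ; module ≤-Reasoning)

  removal-keeps-density : ∀ ρ P P′ V s → A * P ≤ ρ * (V + s) * B → ρ * s * B < A → P′ < P →
                          A * P′ < ρ * V * B
  removal-keeps-density ρ P P′ V s dense small fewer = +-cancelʳ-< A (A * P′) (ρ * V * B) (begin-strict
    A * P′ + A              ≡⟨ +-comm (A * P′) A ⟩
    A + A * P′              ≡⟨ *-suc A P′ ⟨
    A * ℕ.suc P′            ≤⟨ *-monoʳ-≤ A fewer ⟩
    A * P                   ≤⟨ dense ⟩
    ρ * (V + s) * B         ≡⟨ cong (_* B) (*-distribˡ-+ ρ V s) ⟩
    (ρ * V + ρ * s) * B     ≡⟨ *-distribʳ-+ B (ρ * V) (ρ * s) ⟩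
    ρ * V * B + ρ * s * B   <⟨ +-monoʳ-< (ρ * V * B) small ⟩
    ρ * V * B + A           ∎)
    where open ≤-Reasoning

  -- A / B ≤ dens H, with denominators cleared
  DenseAtLeast : LineGraph (ℕ.suc r) → Set
  DenseAtLeast H = A * p H ≤ ℕ.suc r * length (verts H) * B

  remove-small-block : ∀ H {i x} → x ∈ verts H → DenseAtLeast H → ℕ.suc r * deg H i x * B < A →
                       length (verts (removeBlock H i x)) < length (verts H) ×
                       ¬ verts (removeBlock H i x) ≡ [] × DenseAtLeast (removeBlock H i x)
  remove-small-block H {i} {x} x∈ dense small = shrinks , H′≢[] , <⇒≤ dense′
    where
    H′ = removeBlock H i x
    dense′ : A * p H′ < ℕ.suc r * length (verts H′) * B
    dense′ = removal-keeps-density (ℕ.suc r) (p H) (p H′) (length (verts H′)) (deg H i x)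
               (subst (λ n → A * p H ≤ ℕ.suc r * n * B) (sym (length-removeBlock H i x)) dense)
               small (p-removeBlock-< H i x x∈)
    H′≢[] : ¬ verts H′ ≡ []
    H′≢[] H′≡[] = n≮0 (<-≤-trans (subst (λ n → A * p H′ < ℕ.suc r * length n * B) H′≡[] dense′)
                                 (≤-reflexive (cong (_* B) (*-zeroʳ (ℕ.suc r)))))
    shrinks : length (verts H′) < length (verts H)
    shrinks = <-≤-trans (m<m+n _ (∈-length (∈-block⁺ H i x∈)))
                        (≤-reflexive (length-removeBlock H i x))

  DenseSubgraph : LineGraph (ℕ.suc r) → Set
  DenseSubgraph H = Σ (LineGraph (ℕ.suc r)) λ K →
    verts K ⊆ verts H × ¬ verts K ≡ [] × DenseAtLeast K × A ≤ ℕ.suc r * δ K * B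

  densify : ∀ H → Acc _<_ (length (verts H)) → ¬ verts H ≡ [] → DenseAtLeast H → DenseSubgraph H
  densify H (acc smaller) H≢[] dense = by-δ (A ≤? ℕ.suc r * δ H * B)
    where
    by-δ : Dec (A ≤ ℕ.suc r * δ H * B) → DenseSubgraph H
    by-δ (yes δ-large) = H , id , H≢[] , dense , δ-large
    by-δ (no δ-small) =
      let x , i , x∈ , δ≡deg = δ-attained H H≢[]
          shrinks , H′≢[] , dense′ =
            remove-small-block H x∈ dense (subst (λ d → ℕ.suc r * d * B < A) δ≡deg (≰⇒> δ-small))
          K , K⊆H′ , K-props = densify (removeBlock H i x) (smaller shrinks) H′≢[] dense′
      in K , removeBlock-⊆ H i x ∘ K⊆H′ , K-props

open import Data.Rational using (_≤_; _*_; _/_)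

toℚᵘ-/ : ∀ a b → toℚᵘ ((+ a) / ℕ.suc b) ℚᵘ.≃ ℚᵘ.mkℚᵘ (+ a) b
toℚᵘ-/ a b = toℚᵘ-fromℚᵘ (ℚᵘ.mkℚᵘ (+ a) b)

cross-≤⇒/≤/ : ∀ a b c d → a ℕ.* ℕ.suc d ℕ.≤ c ℕ.* ℕ.suc b → (+ a) / ℕ.suc b ≤ (+ c) / ℕ.suc d
cross-≤⇒/≤/ a b c d ad≤cb = toℚᵘ-cancel-≤ (begin
  toℚᵘ ((+ a) / ℕ.suc b)  ≃⟨ toℚᵘ-/ a b ⟩
  ℚᵘ.mkℚᵘ (+ a) b         ≤⟨ ℚᵘ.*≤* (subst₂ ℤ._≤_ (ℤₚ.pos-* a (ℕ.suc d)) (ℤₚ.pos-* c (ℕ.suc b)) (ℤ.+≤+ ad≤cb)) ⟩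
  ℚᵘ.mkℚᵘ (+ c) d         ≃⟨ toℚᵘ-/ c d ⟨
  toℚᵘ ((+ c) / ℕ.suc d)  ∎)
  where open ℚᵘₚ.≤-Reasoning

cross-≤⇒/*1/≤ : ∀ a b m r → a ℕ.≤ ℕ.suc r ℕ.* m ℕ.* ℕ.suc b →
                ((+ a) / ℕ.suc b) * ((+ 1) / ℕ.suc r) ≤ (+ m) / 1
cross-≤⇒/*1/≤ a b m r a≤rmb = toℚᵘ-cancel-≤ (begin
  toℚᵘ (a/b * 1/r)                       ≃⟨ toℚᵘ-homo-* a/b 1/r ⟩
  toℚᵘ a/b ℚᵘ.* toℚᵘ 1/r                 ≃⟨ ℚᵘₚ.*-cong (toℚᵘ-/ a b) (toℚᵘ-/ 1 r) ⟩
  ℚᵘ.mkℚᵘ (+ a) b ℚᵘ.* ℚᵘ.mkℚᵘ (+ 1) r   ≤⟨ ℚᵘ.*≤* cross ⟩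
  ℚᵘ.mkℚᵘ (+ m) 0                        ≃⟨ toℚᵘ-/ m 0 ⟨
  toℚᵘ ((+ m) / 1)                       ∎)
  where
  open ℚᵘₚ.≤-Reasoning
  a/b = (+ a) / ℕ.suc b
  1/r = (+ 1) / ℕ.suc r
  rearrange : ∀ r m b → ℕ.suc r ℕ.* m ℕ.* ℕ.suc b ≡ m ℕ.* (ℕ.suc b ℕ.* ℕ.suc r)
  rearrange = solve-∀
  cross : (+ a ℤ.* + 1) ℤ.* + 1 ℤ.≤ + m ℤ.* + (ℕ.suc b ℕ.* ℕ.suc r)
  cross = subst₂ ℤ._≤_ (sym (trans (ℤₚ.*-identityʳ _) (ℤₚ.*-identityʳ _))) (ℤₚ.pos-* m _)
                 (ℤ.+≤+ (ℕₚ.≤-trans a≤rmb (ℕₚ.≤-reflexive (rearrange r m b))))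

-- The numerator is an argument so that callers can keep it syntactically equal to theirs:
-- unifying two different-looking rationals makes Agda normalise _/_ and hence p, which never finishes.
/≡dens : ∀ {r} (H : LineGraph r) a k → a ≡ r ℕ.* length (verts H) → p H ≡ ℕ.suc k →
         (+ a) / ℕ.suc k ≡ dens H
/≡dens H a k refl p≡ with p H
/≡dens H a k refl refl | _ = refl

dense⇒≤dens : ∀ {r} (H : LineGraph (ℕ.suc r)) → ¬ verts H ≡ [] → ∀ a b →
              a ℕ.* p H ℕ.≤ ℕ.suc r ℕ.* length (verts H) ℕ.* ℕ.suc b → (+ a) / ℕ.suc b ≤ dens H
dense⇒≤dens {r} H H≢[] a b dense =
  subst ((+ a) / ℕ.suc b ≤_) (/≡dens H rV k refl p≡)
        (cross-≤⇒/≤/ a b rV k (subst (λ P → a ℕ.* P ℕ.≤ rV ℕ.* ℕ.suc b) p≡ dense))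
  where
  rV = ℕ.suc r ℕ.* length (verts H)
  k  = ℕ.pred (p H)
  p≡ = p≡suc-pred H H≢[]

lemma3p1 : (r : ℕ) → {{_ : NonZero r}} → (G : LineGraph r) → ¬ (verts G ≡ []) →
    Σ (LineGraph r) (λ H →
    (verts H ⊆ verts G) × ¬ (verts H ≡ []) ×
    (dens G ≤ dens H) × (dens G * ((+ 1) / r) ≤ (+ δ H) / 1))
lemma3p1 (ℕ.suc r) G G≢[] =
  let K , K⊆G , K≢[] , K-dense , K-δ = densify G (<-wellFounded _) G≢[] G-dense
  in K , K⊆G , K≢[] , subst (_≤ dens K) dens-G (dense⇒≤dens K K≢[] a k K-dense)
         , subst (λ d → d * ((+ 1) / ℕ.suc r) ≤ (+ δ K) / 1) dens-G (cross-≤⇒/*1/≤ a k (δ K) r K-δ)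
  where
  k = ℕ.pred (p G)
  a = ℕ.suc r ℕ.* length (verts G)
  open Densification a (ℕ.suc k)
  G-dense : DenseAtLeast G
  G-dense = ℕₚ.≤-reflexive (cong (a ℕ.*_) (p≡suc-pred G G≢[]))
  dens-G : (+ a) / ℕ.suc k ≡ dens G
  dens-G = /≡dens G a k refl (p≡suc-pred G G≢[])
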